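{- Let $q=p^m$ with $p$ an odd prime and $m\in\mathbb{N}$, and let $k\in\mathbb{N}$ with $k\mid q-1$. Suppose $\Gamma(k,q)$ is directed and strongly connected. Then $\Gamma(k,q)$ has period $1$, with the only exception of $\Gamma(p-1,p)$ (i.e. $m=1$, $k=p-1$), which has period $p$.
   Context: $R_k=\{x^k:x\in\mathbb{F}_q^*\}$; the generalized Paley graph $\Gamma(k,q)$ has vertex set $\mathbb{F}_q$ and an arc $x\to y$ iff $y-x\in R_k$; it is directed iff $R_k\neq -R_k$. The period of a digraph is the greatest common divisor of the lengths of all its directed cycles. -}

module Defs where

open import Level using (0ℓ)
open import Algebra.Bundles using (CommutativeRing; Semiring)
import Algebra.Definitions.RawSemiring as RawSemiringDefs
open import Data.Nat using (ℕ; zero; suc; _<_; _≤_)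
open import Data.Nat.Divisibility using (_∣_)
open import Data.Fin using (Fin)
open import Data.Product using (Σ; ∃; _×_; _,_)
open import Function.Bundles using (_↔_)
open import Relation.Binary.PropositionalEquality using (_≡_; _≢_)
open import Relation.Nullary using (¬_)

-- It is given as a commutative
-- ring whose (setoid) equality is propositional equality, with 0 ≠ 1,
-- every nonzero element invertible, and an explicit bijection with Fin q.
-- (Every finite field of order q is isomorphic to F_q.)
record FiniteField (q : ℕ) : Set₁ where
  field
    commRing : CommutativeRing 0ℓ 0ℓ
  open CommutativeRing commRing public
  field
    ≈⇒≡     : ∀ {x y} → x ≈ y → x ≡ y
    0≢1     : ¬ (0# ≡ 1#)
    inverse : ∀ x → x ≢ 0# → ∃ λ y → x * y ≡ 1#
    enum    : Fin q ↔ Carrier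
  open RawSemiringDefs (Semiring.rawSemiring semiring) public using (_^_)

module Paley {q : ℕ} (F : FiniteField q) (k : ℕ) where
  open FiniteField F

  InR : Carrier → Set
  InR r = ∃ λ x → (x ≢ 0#) × (x ^ k ≡ r)

  Arc : Carrier → Carrier → Set
  Arc x y = InR (y - x)

  Directed : Set
  Directed = ¬ (∀ r → (InR r → InR (- r)) × (InR (- r) → InR r))

  Walk : Carrier → Carrier → ℕ → Set
  Walk x y n = Σ (ℕ → Carrier) λ v →
    (v 0 ≡ x) × (v n ≡ y) × (∀ i → i < n → Arc (v i) (v (suc i)))

  StronglyConnected : Set
  StronglyConnected = ∀ x y → ∃ λ n → Walk x y n

  Cycle : ℕ → Set
  Cycle n = (1 ≤ n) × Σ (ℕ → Carrier) λ v →
    (v n ≡ v 0) ×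
    (∀ i → i < n → Arc (v i) (v (suc i))) ×
    (∀ i j → i < j → j < n → v i ≢ v j)

  HasPeriod : ℕ → Set
  HasPeriod d = (∀ n → Cycle n → d ∣ n) ×
                (∀ e → (∀ n → Cycle n → e ∣ n) → e ∣ d)

-- Every y ^ k with y ≠ 0 lies in R_k; in particular 1 does, so 0 → 1 → 2 → ⋯ is a directed cycle
-- whose length is the characteristic c, a divisor of q.  If some g = y ^ k differs from 1, the
-- partial sums of 1 + g + g² + ⋯ form a directed cycle whose length is the multiplicative order
-- of g, a divisor of q - 1; the two lengths are coprime, so the period is 1.  Otherwise R_k = {1},
-- every arc is x → x + 1 and every cycle length is a multiple of c.  Strong connectivity then
-- makes every element a multiple of 1, so q = c is prime; the q - 1 nonzero elements are roots
-- of x ^ k - 1, so k ≥ q - 1 and, as k ∣ q - 1, the digraph is Γ(p - 1, p), whose period is c = p.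

module Submission where

open import Defs
open import Level using (_⊔_)
open import Algebra.Bundles using (Monoid; Group; CommutativeMonoid; Semiring; CommutativeRing)
import Algebra.Properties.Monoid.Mult as MonoidMult
open import Data.Bool using (if_then_else_)
open import Data.Nat as ℕ
  using (ℕ; zero; suc; _∸_; _≤_; _<_; z≤n; s≤s; z<s; s≤s⁻¹; NonZero; NonTrivial;
         >-nonZero; >-nonZero⁻¹; n>1⇒nonTrivial; nonTrivial⇒≢1; nonTrivial⇒n>1)
open import Data.Nat.Properties
  using (≤-refl; ≤-trans; ≤-antisym; <⇒≤; ≤-<-trans; <⇒≢; ≤∧≢⇒<; m≤n⇒m<n∨m≡n; m∸n≤m;
         m+[n∸m]≡n; m<n⇒0<n∸m; m<m*n; ^-monoʳ-<; n<1+n)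
import Data.Nat.Properties as ℕₚ
open import Data.Nat.DivMod using (_%_; _/_; m≡m%n+[m/n]*n; m%n<n)
open import Data.Nat.Divisibility
  using (_∣_; ∣-refl; ∣-trans; 1∣_; ∣⇒≤; 0∣⇒≡0; ∣1⇒≡1; ∣m+n∣m⇒∣n; m∣m*n; m%n≡0⇒n∣m;
         quotient; quotient≢0; quotient-<; m∣n⇒n≡quotient*m)
open import Data.Nat.Coprimality using (Coprime)
open import Data.Nat.Primality using (Prime; prime; composite; prime⇒irreducible; prime⇒nonTrivial)
open import Data.Fin using (Fin; zero; suc; toℕ; fromℕ<; punchIn)
import Data.Fin.Properties as Fin
open import Data.List using (List; []; _∷_; length; applyUpTo)
import Data.List as List
open import Data.List.Properties using (length-replicate; length-applyUpTo)
open import Data.List.Relation.Unary.All using (All; []; _∷_)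
import Data.List.Relation.Unary.All as All
import Data.List.Relation.Unary.All.Properties as Allₚ
open import Data.List.Relation.Unary.AllPairs using (AllPairs; []; _∷_)
import Data.List.Relation.Unary.AllPairs.Properties as AllPairsₚ
open import Data.Maybe using (nothing)
open import Data.Product using (∃; ∃-syntax; _×_; _,_; proj₁; proj₂)
open import Data.Sum using (_⊎_; inj₁; inj₂; [_,_]′)
open import Data.Vec.Functional using (replicate)
open import Function using (_∘_)
open import Function.Bundles using (Inverse; _↔_; mk↔ₛ′)
open import Function.Construct.Composition using (_↔-∘_)
open import Function.Construct.Symmetry using (↔-sym)
open import Function.Properties.Inverse using (Inverse⇒Injection)
open import Relation.Binary.Definitions using (Decidable; DecidableEquality)
open import Relation.Binary.PropositionalEquality as ≡ using (_≡_; _≢_)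
open import Relation.Nullary using (¬_; Dec; does; yes; no; contradiction; ¬?; _×-dec_)
open import Relation.Nullary.Decidable using (map′; via-injection; dec-true; dec-false; decidable-stable)

least-positive : ∀ {p} {P : ℕ → Set p} → (∀ n → Dec (P n)) → ∀ {n} → 0 < n → P n →
                 ∃[ m ] 0 < m × P m × (∀ {i} → 0 < i → i < m → ¬ P i)
least-positive {P = P} P? {n} 0<n Pn with least-upTo n
  where
  least-upTo : ∀ b → (∀ {i} → 0 < i → i ≤ b → ¬ P i) ⊎
                     (∃[ m ] 0 < m × P m × (∀ {i} → 0 < i → i < m → ¬ P i))
  least-upTo zero = inj₁ λ { () z≤n }
  least-upTo (suc b) with least-upTo b
  ... | inj₂ least = inj₂ least
  ... | inj₁ none with P? (suc b)
  ...   | yes Psb = inj₂ (suc b , z<s , Psb , λ 0<i i<sb → none 0<i (s≤s⁻¹ i<sb))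
  ...   | no ¬Psb = inj₁ λ 0<i i≤sb →
          [ (λ i<sb → none 0<i (s≤s⁻¹ i<sb)) , (λ { ≡.refl → ¬Psb }) ]′ (m≤n⇒m<n∨m≡n i≤sb)
... | inj₁ none  = contradiction Pn (none 0<n ≤-refl)
... | inj₂ least = least

divisors-of-successive-coprime : ∀ {a b n} → a ∣ suc n → b ∣ n → Coprime a b
divisors-of-successive-coprime {n = n} a∣1+n b∣n {i} (i∣a , i∣b) =
  ∣1⇒≡1 (∣m+n∣m⇒∣n (≡.subst (i ∣_) (ℕₚ.+-comm 1 n) (∣-trans i∣a a∣1+n)) (∣-trans i∣b b∣n))

prime-power-prime⇒exponent≡1 : ∀ {p} m → Prime p → Prime (p ℕ.^ m) → m ≡ 1
prime-power-prime⇒exponent≡1 zero _ p⁰-prime =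
  contradiction ≡.refl (nonTrivial⇒≢1 {{prime⇒nonTrivial p⁰-prime}})
prime-power-prime⇒exponent≡1 (suc zero) _ _ = ≡.refl
prime-power-prime⇒exponent≡1 {p} (suc (suc m)) p-prime pᵐ-prime
  with prime⇒irreducible pᵐ-prime (m∣m*n {p} (p ℕ.^ suc m))
... | inj₁ p≡1   = contradiction p≡1 (nonTrivial⇒≢1 {{prime⇒nonTrivial p-prime}})
... | inj₂ p≡pᵐ = contradiction p≡pᵐ (<⇒≢ (m<m*n p (p ℕ.^ suc m) {{>-nonZero 0<p}} 1<p^[1+m]))
  where
  1<p = nonTrivial⇒n>1 p {{prime⇒nonTrivial p-prime}}
  0<p = ≤-trans (s≤s z≤n) 1<p
  1<p^[1+m] = ^-monoʳ-< p 1<p {0} {suc m} z<s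

module _ {a ℓ} (M : Monoid a ℓ) where

  open Monoid M
  open import Relation.Binary.Reasoning.Setoid setoid

  x∙y≈ε⇒x∙[y∙z]≈z : ∀ {x y} → x ∙ y ≈ ε → ∀ z → x ∙ (y ∙ z) ≈ z
  x∙y≈ε⇒x∙[y∙z]≈z {x} {y} xy≈ε z = begin
    x ∙ (y ∙ z)  ≈⟨ assoc x y z ⟨
    x ∙ y ∙ z    ≈⟨ ∙-congʳ xy≈ε ⟩
    ε ∙ z        ≈⟨ identityˡ z ⟩
    z            ∎

module _ {a ℓ} (G : Group a ℓ) where

  open Group G
  open import Relation.Binary.Reasoning.Setoid setoid

  x∙y⁻¹∙y≈x : ∀ x y → x ∙ y ⁻¹ ∙ y ≈ x
  x∙y⁻¹∙y≈x x y = begin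
    x ∙ y ⁻¹ ∙ y    ≈⟨ assoc x (y ⁻¹) y ⟩
    x ∙ (y ⁻¹ ∙ y)  ≈⟨ ∙-congˡ (inverseˡ y) ⟩
    x ∙ ε           ≈⟨ identityʳ x ⟩
    x               ∎

module MonoidOrder {a ℓ} (M : Monoid a ℓ) where

  open import Data.Nat using (_+_; _*_)
  open Monoid M
  open MonoidMult M using (×-homo-+; ×-assocˡ; ×-congʳ) renaming (_×_ to _·_)
  open import Relation.Binary.Reasoning.Setoid setoid

  LeftCancellable : Carrier → Set (a ⊔ ℓ)
  LeftCancellable x = ∀ {y z} → x ∙ y ≈ x ∙ z → y ≈ z

  ·-leftCancellable : ∀ {x} → LeftCancellable x → ∀ n → LeftCancellable (n · x)
  ·-leftCancellable x-canc zero {y} {z} ε∙y≈ε∙z = begin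
    y      ≈⟨ identityˡ y ⟨
    ε ∙ y  ≈⟨ ε∙y≈ε∙z ⟩
    ε ∙ z  ≈⟨ identityˡ z ⟩
    z      ∎
  ·-leftCancellable {x} x-canc (suc n) {y} {z} eq =
    ·-leftCancellable x-canc n (x-canc (begin
      x ∙ (n · x ∙ y)  ≈⟨ assoc x (n · x) y ⟨
      x ∙ n · x ∙ y    ≈⟨ eq ⟩
      x ∙ n · x ∙ z    ≈⟨ assoc x (n · x) z ⟩
      x ∙ (n · x ∙ z)  ∎))

  n·ε≈ε : ∀ n → n · ε ≈ ε
  n·ε≈ε zero    = refl
  n·ε≈ε (suc n) = trans (identityˡ (n · ε)) (n·ε≈ε n)

  i·x≈j·x⇒[j∸i]·x≈ε : ∀ {x i j} → LeftCancellable x → i ≤ j → i · x ≈ j · x → (j ∸ i) · x ≈ ε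
  i·x≈j·x⇒[j∸i]·x≈ε {x} {i} {j} x-canc i≤j i·x≈j·x = ·-leftCancellable x-canc i (begin
    i · x ∙ (j ∸ i) · x  ≈⟨ ×-homo-+ x i (j ∸ i) ⟨
    (i + (j ∸ i)) · x    ≡⟨ ≡.cong (_· x) (m+[n∸m]≡n i≤j) ⟩
    j · x                ≈⟨ i·x≈j·x ⟨
    i · x                ≈⟨ identityʳ (i · x) ⟨
    i · x ∙ ε            ∎)

  record IsOrder (x : Carrier) (o : ℕ) : Set ℓ where
    field
      positive    : 0 < o
      annihilates : o · x ≈ ε
      minimal     : ∀ {i} → 0 < i → i < o → ¬ i · x ≈ ε

    instance
      nonZero : NonZero o
      nonZero = >-nonZero positive

    n·x≈[n%o]·x : ∀ n → n · x ≈ (n % o) · x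
    n·x≈[n%o]·x n = begin
      n · x                             ≡⟨ ≡.cong (_· x) (m≡m%n+[m/n]*n n o) ⟩
      (n % o + n / o * o) · x           ≈⟨ ×-homo-+ x (n % o) (n / o * o) ⟩
      (n % o) · x ∙ (n / o * o) · x     ≈⟨ ∙-congˡ (×-assocˡ x (n / o) o) ⟨
      (n % o) · x ∙ (n / o) · (o · x)   ≈⟨ ∙-congˡ (×-congʳ (n / o) annihilates) ⟩
      (n % o) · x ∙ (n / o) · ε         ≈⟨ ∙-congˡ (n·ε≈ε (n / o)) ⟩
      (n % o) · x ∙ ε                   ≈⟨ identityʳ _ ⟩
      (n % o) · x                       ∎

    ∣-annihilating : ∀ {n} → n · x ≈ ε → o ∣ n
    ∣-annihilating {n} n·x≈ε with n % o in n%o≡r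
    ... | zero  = m%n≡0⇒n∣m n o n%o≡r
    ... | suc r = contradiction
                    (≡.subst (λ m → m · x ≈ ε) n%o≡r (trans (sym (n·x≈[n%o]·x n)) n·x≈ε))
                    (minimal z<s (≡.subst (_< o) n%o≡r (m%n<n n o)))

    ·-injective : LeftCancellable x → ∀ {i j} → i < j → j < o → ¬ i · x ≈ j · x
    ·-injective x-canc {i} {j} i<j j<o i·x≈j·x =
      minimal (m<n⇒0<n∸m i<j) (≤-<-trans (m∸n≤m j i) j<o)
              (i·x≈j·x⇒[j∸i]·x≈ε x-canc (<⇒≤ i<j) i·x≈j·x)

  order-exists : Decidable _≈_ → ∀ {N x} (ι : Carrier → Fin N) → (∀ {y z} → ι y ≡ ι z → y ≈ z) →
                 LeftCancellable x → ∃ (IsOrder x)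
  order-exists _≈?_ {N} {x} ι ι-injective x-canc
    with Fin.pigeonhole (n<1+n N) (λ i → ι (toℕ i · x))
  ... | i , j , i<j , ι[i·x]≡ι[j·x] =
    let o , 0<o , o·x≈ε , minimal = least-positive (λ n → (n · x) ≈? ε) (m<n⇒0<n∸m i<j)
          (i·x≈j·x⇒[j∸i]·x≈ε x-canc (<⇒≤ i<j) (ι-injective ι[i·x]≡ι[j·x]))
    in o , record { positive = 0<o ; annihilates = o·x≈ε ; minimal = minimal }

module CommutativeMonoidSum {a ℓ} (M : CommutativeMonoid a ℓ) where

  open CommutativeMonoid M
  open import Algebra.Properties.CommutativeMonoid.Sum M
    using (sum; sum-permute; sum-remove; sum-cong-≗; sum-cong-≋; sum-replicate)
  open MonoidMult monoid using () renaming (_×_ to _·_)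
  open import Relation.Binary.Reasoning.Setoid setoid

  sum-reindex : ∀ {b} {A : Set b} {N} (e : Fin N ↔ A) (φ : A ↔ A) (w : A → Carrier) →
                sum (w ∘ Inverse.to e) ≈ sum (w ∘ Inverse.to φ ∘ Inverse.to e)
  sum-reindex {N = N} e φ w = begin
    sum (w ∘ to e)                          ≈⟨ sum-permute (w ∘ to e) (↔-sym e ↔-∘ (φ ↔-∘ e)) ⟩
    sum (w ∘ to e ∘ from e ∘ to φ ∘ to e)   ≡⟨ sum-cong-≗ {N} (λ i → ≡.cong w (strictlyInverseˡ e (to φ (to e i)))) ⟩
    sum (w ∘ to φ ∘ to e)                   ∎
    where open Inverse

  sum-const-except : ∀ {N} (z : Fin N) (w : Fin N → Carrier) {x} →
                     w z ≈ ε → (∀ i → i ≢ z → w i ≈ x) → sum w ≈ (N ∸ 1) · x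
  sum-const-except {suc N} z w {x} wz≈ε w≈x = begin
    sum w                      ≈⟨ sum-remove {i = z} w ⟩
    w z ∙ sum (w ∘ punchIn z)  ≈⟨ ∙-cong wz≈ε (sum-cong-≋ (λ i → w≈x _ (Fin.punchInᵢ≢i z i))) ⟩
    ε ∙ sum (replicate N x)    ≈⟨ identityˡ _ ⟩
    sum (replicate N x)        ≈⟨ sum-replicate N ⟩
    N · x                      ∎

module MonicPolynomial {c ℓ} (R : CommutativeRing c ℓ) where

  open CommutativeRing R
  open import Algebra.Definitions.RawSemiring (Semiring.rawSemiring semiring) using (_^_)
  open import Algebra.Properties.Group +-group using (x∙y⁻¹≈ε⇒x≈y)
  open import Relation.Binary.Reasoning.Setoid setoid

  -- [a₀, …, a_{d-1}] stands for the monic polynomial xᵈ + a_{d-1} x^{d-1} + ⋯ + a₀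
  eval : List Carrier → Carrier → Carrier
  eval []       x = 1#
  eval (a ∷ as) x = a + x * eval as x

  eval-cong : ∀ as {x y} → x ≈ y → eval as x ≈ eval as y
  eval-cong []       x≈y = refl
  eval-cong (a ∷ as) x≈y = +-congˡ (*-cong x≈y (eval-cong as x≈y))

  xⁿ⁺¹-1 : ℕ → List Carrier
  xⁿ⁺¹-1 n = - 1# ∷ List.replicate n 0#

  eval-xⁿ⁺¹-1 : ∀ n x → eval (xⁿ⁺¹-1 n) x ≈ - 1# + x ^ suc n
  eval-xⁿ⁺¹-1 n x = +-congˡ (*-congˡ (eval-0s n))
    where
    eval-0s : ∀ n → eval (List.replicate n 0#) x ≈ x ^ n
    eval-0s zero    = refl
    eval-0s (suc n) = trans (+-identityˡ _) (*-congˡ (eval-0s n))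

  -- divide r as is the quotient of a ∷ as by x - r, whatever a is
  divide : Carrier → List Carrier → List Carrier
  divide r []       = []
  divide r (a ∷ as) = eval (a ∷ as) r ∷ divide r as

  length-divide : ∀ r as → length (divide r as) ≡ length as
  length-divide r []       = ≡.refl
  length-divide r (a ∷ as) = ≡.cong suc (length-divide r as)

  private
    module Identities where
      open import Tactic.RingSolver using (solve-∀)
      open import Tactic.RingSolver.Core.AlmostCommutativeRing using (AlmostCommutativeRing; fromCommutativeRing)

      ACR : AlmostCommutativeRing c ℓ
      ACR = fromCommutativeRing R (λ _ → nothing)
      open AlmostCommutativeRing ACR using () renaming (_+_ to _⊕_; _*_ to _⊛_; _≈_ to _≋_)

      linear : ∀ a d r u → a ⊕ (d ⊕ r) ⊛ u ≋ d ⊛ u ⊕ (a ⊕ r ⊛ u)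
      linear = solve-∀ ACR

      horner : ∀ a d r Q v → a ⊕ (d ⊕ r) ⊛ (d ⊛ Q ⊕ v) ≋ d ⊛ (v ⊕ (d ⊕ r) ⊛ Q) ⊕ (a ⊕ r ⊛ v)
      horner = solve-∀ ACR

    -- the point is written as d + r because the ring solver cannot cancel - r against r
    eval-divide′ : ∀ r d a as → eval (a ∷ as) (d + r) ≈ d * eval (divide r as) (d + r) + eval (a ∷ as) r
    eval-divide′ r d a []        = Identities.linear a d r 1#
    eval-divide′ r d a (a′ ∷ as) = begin
      a + (d + r) * eval (a′ ∷ as) (d + r)                               ≈⟨ +-congˡ (*-congˡ (eval-divide′ r d a′ as)) ⟩
      a + (d + r) * (d * eval (divide r as) (d + r) + eval (a′ ∷ as) r)  ≈⟨ Identities.horner a d r _ _ ⟩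
      d * eval (divide r (a′ ∷ as)) (d + r) + eval (a ∷ a′ ∷ as) r       ∎

  eval-divide : ∀ r a as x → eval (a ∷ as) x ≈ (x - r) * eval (divide r as) x + eval (a ∷ as) r
  eval-divide r a as x = begin
    eval (a ∷ as) x                                            ≈⟨ eval-cong (a ∷ as) x-r+r≈x ⟨
    eval (a ∷ as) (x - r + r)                                  ≈⟨ eval-divide′ r (x - r) a as ⟩
    (x - r) * eval (divide r as) (x - r + r) + eval (a ∷ as) r ≈⟨ +-congʳ (*-congˡ (eval-cong (divide r as) x-r+r≈x)) ⟩
    (x - r) * eval (divide r as) x + eval (a ∷ as) r           ∎
    where x-r+r≈x = x∙y⁻¹∙y≈x +-group x r

  module _ (1≉0 : ¬ 1# ≈ 0#) (no-zero-divisors : ∀ {x y} → x * y ≈ 0# → x ≈ 0# ⊎ y ≈ 0#) where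

    roots≤degree : ∀ (rs as : List Carrier) → AllPairs (λ r s → ¬ r ≈ s) rs →
                   All (λ r → eval as r ≈ 0#) rs → length rs ≤ length as
    roots≤degree []       as       _            _                   = z≤n
    roots≤degree (r ∷ rs) []       _            (1≈0 ∷ _)           = contradiction 1≈0 1≉0
    roots≤degree (r ∷ rs) (a ∷ as) (r≉rs ∷ rs≉) (r-root ∷ rs-roots) =
      s≤s (≡.subst (length rs ≤_) (length-divide r as)
            (roots≤degree rs (divide r as) rs≉ (All.zipWith divide-root (r≉rs , rs-roots))))
      where
      divide-root : ∀ {s} → ¬ r ≈ s × eval (a ∷ as) s ≈ 0# → eval (divide r as) s ≈ 0#
      divide-root {s} (r≉s , s-root) with no-zero-divisors (begin
        (s - r) * eval (divide r as) s                   ≈⟨ +-identityʳ _ ⟨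
        (s - r) * eval (divide r as) s + 0#              ≈⟨ +-congˡ r-root ⟨
        (s - r) * eval (divide r as) s + eval (a ∷ as) r ≈⟨ eval-divide r a as s ⟨
        eval (a ∷ as) s                                  ≈⟨ s-root ⟩
        0#                                               ∎)
      ... | inj₁ s-r≈0 = contradiction (sym (x∙y⁻¹≈ε⇒x≈y s r s-r≈0)) r≉s
      ... | inj₂ q≈0   = q≈0

module FiniteFieldTheory {q : ℕ} (F : FiniteField q) where

  open FiniteField F hiding (zero)
  open import Algebra.Properties.Group +-group using (∙-cancelˡ; ∙-cancelʳ)
  open import Algebra.Properties.Semiring.Mult semiring using (×1-homo-*) renaming (_×_ to _·_)
  open import Relation.Binary.Reasoning.Setoid setoid
  open Inverse enum using (to; from; strictlyInverseˡ; strictlyInverseʳ)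

  instance
    q-nonZero : NonZero q
    q-nonZero = Fin.nonZeroIndex (from 0#)

  _≟_ : DecidableEquality Carrier
  _≟_ = via-injection (Inverse⇒Injection (↔-sym enum)) Data.Fin._≟_

  _≈?_ : Decidable _≈_
  x ≈? y = map′ reflexive ≈⇒≡ (x ≟ y)

  from-injective : ∀ {x y} → from x ≡ from y → x ≈ y
  from-injective {x} {y} eq = reflexive (≡.trans (≡.sym (strictlyInverseˡ x))
                                        (≡.trans (≡.cong to eq) (strictlyInverseˡ y)))

  1≉0 : ¬ 1# ≈ 0#
  1≉0 1≈0 = 0≢1 (≡.sym (≈⇒≡ 1≈0))

  +-leftCancellable : ∀ x {y z} → x + y ≈ x + z → y ≈ z
  +-leftCancellable x = ∙-cancelˡ x _ _

  +-rightCancellable : ∀ x {y z} → y + x ≈ z + x → y ≈ z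
  +-rightCancellable x = ∙-cancelʳ x _ _

  inverse-of : ∀ {x} → x ≢ 0# → Carrier
  inverse-of {x} x≢0 = proj₁ (inverse x x≢0)

  *-inverseʳ : ∀ {x} (x≢0 : x ≢ 0#) → x * inverse-of x≢0 ≈ 1#
  *-inverseʳ {x} x≢0 = reflexive (proj₂ (inverse x x≢0))

  *-inverseˡ : ∀ {x} (x≢0 : x ≢ 0#) → inverse-of x≢0 * x ≈ 1#
  *-inverseˡ {x} x≢0 = trans (*-comm _ x) (*-inverseʳ x≢0)

  *-leftCancellable : ∀ {x} → x ≢ 0# → ∀ {y z} → x * y ≈ x * z → y ≈ z
  *-leftCancellable {x} x≢0 {y} {z} xy≈xz = begin
    y                          ≈⟨ x∙y≈ε⇒x∙[y∙z]≈z *-monoid (*-inverseˡ x≢0) y ⟨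
    inverse-of x≢0 * (x * y)   ≈⟨ *-congˡ xy≈xz ⟩
    inverse-of x≢0 * (x * z)   ≈⟨ x∙y≈ε⇒x∙[y∙z]≈z *-monoid (*-inverseˡ x≢0) z ⟩
    z                          ∎

  no-zero-divisors : ∀ {x y} → x * y ≈ 0# → x ≈ 0# ⊎ y ≈ 0#
  no-zero-divisors {x} {y} xy≈0 with x ≟ 0#
  ... | yes x≡0 = inj₁ (reflexive x≡0)
  ... | no  x≢0 = inj₂ (*-leftCancellable x≢0 (trans xy≈0 (sym (zeroʳ x))))

  *-nonzero : ∀ {x y} → x ≢ 0# → y ≢ 0# → x * y ≢ 0#
  *-nonzero x≢0 y≢0 xy≡0 = [ x≢0 ∘ ≈⇒≡ , y≢0 ∘ ≈⇒≡ ]′ (no-zero-divisors (reflexive xy≡0))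

  ^-nonzero : ∀ {x} n → x ≢ 0# → x ^ n ≢ 0#
  ^-nonzero zero    x≢0 = 0≢1 ∘ ≡.sym
  ^-nonzero (suc n) x≢0 = *-nonzero x≢0 (^-nonzero n x≢0)

  ^-swap : ∀ x m n → (x ^ m) ^ n ≈ (x ^ n) ^ m
  ^-swap x m n = begin
    (x ^ m) ^ n      ≈⟨ ^-assocʳ x m n ⟩
    x ^ (m ℕ.* n)    ≡⟨ ≡.cong (x ^_) (ℕₚ.*-comm m n) ⟩
    x ^ (n ℕ.* m)    ≈⟨ ^-assocʳ x n m ⟨
    (x ^ n) ^ m      ∎
    where open import Algebra.Properties.Semiring.Exp semiring using (^-assocʳ)

  translation : Carrier → Carrier ↔ Carrier
  translation a = mk↔ₛ′ (a +_) (- a +_)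
    (≈⇒≡ ∘ x∙y≈ε⇒x∙[y∙z]≈z +-monoid (-‿inverseʳ a))
    (≈⇒≡ ∘ x∙y≈ε⇒x∙[y∙z]≈z +-monoid (-‿inverseˡ a))

  scaling : ∀ {a} → a ≢ 0# → Carrier ↔ Carrier
  scaling {a} a≢0 = mk↔ₛ′ (a *_) (inverse-of a≢0 *_)
    (≈⇒≡ ∘ x∙y≈ε⇒x∙[y∙z]≈z *-monoid (*-inverseʳ a≢0))
    (≈⇒≡ ∘ x∙y≈ε⇒x∙[y∙z]≈z *-monoid (*-inverseˡ a≢0))

  module Additive       = MonoidOrder +-monoid
  module Multiplicative = MonoidOrder *-monoid

  characteristic : ∃ (Additive.IsOrder 1#)
  characteristic = Additive.order-exists _≈?_ from from-injective (+-leftCancellable 1#)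

  char : ℕ
  char = proj₁ characteristic

  char-isOrder : Additive.IsOrder 1# char
  char-isOrder = proj₂ characteristic

  open Additive.IsOrder char-isOrder using (annihilates; minimal; nonZero; ∣-annihilating)

  1<char : 1 < char
  1<char = ≤∧≢⇒< (Additive.IsOrder.positive char-isOrder) λ 1≡char →
    1≉0 (trans (sym (+-identityʳ 1#)) (≡.subst (λ n → n · 1# ≈ 0#) (≡.sym 1≡char) annihilates))

  instance
    char-nonTrivial : NonTrivial char
    char-nonTrivial = n>1⇒nonTrivial 1<char

  char-prime : Prime char
  char-prime = prime λ (composite {d} d<char d∣char) →
    let e = quotient d∣char
        [e·1][d·1]≈0 = trans (sym (×1-homo-* e d))
                             (≡.subst (λ n → n · 1# ≈ 0#) (m∣n⇒n≡quotient*m d∣char) annihilates)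
        0<e = >-nonZero⁻¹ e {{quotient≢0 d∣char}}
        0<d = ≤-trans (s≤s z≤n) (nonTrivial⇒n>1 d)
    in [ minimal 0<e (quotient-< d∣char) , minimal 0<d d<char ]′ (no-zero-divisors [e·1][d·1]≈0)

  -- Translation by 1 permutes the field, so Σ x = Σ (1 + x) = q · 1 + Σ x.
  char∣q : char ∣ q
  char∣q = ∣-annihilating (+-leftCancellable (sum to) (begin
    sum to + q · 1#                 ≈⟨ +-comm _ _ ⟩
    q · 1# + sum to                 ≈⟨ +-congʳ (sum-replicate q) ⟨
    sum (replicate q 1#) + sum to   ≈⟨ ∑-distrib-+ (replicate q 1#) to ⟨
    sum ((1# +_) ∘ to)              ≈⟨ sum-reindex enum (translation 1#) (λ x → x) ⟨
    sum to                          ≈⟨ +-identityʳ _ ⟨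
    sum to + 0#                     ∎))
    where
    open CommutativeMonoidSum +-commutativeMonoid using (sum-reindex)
    open import Algebra.Properties.CommutativeMonoid.Sum +-commutativeMonoid
      using (sum; ∑-distrib-+; sum-replicate)

  ifZero_then_else_ : Carrier → Carrier → Carrier → Carrier
  ifZero x then a else b = if does (x ≟ 0#) then a else b

  ifZero-0 : ∀ {x a c} → x ≡ 0# → (ifZero x then a else c) ≡ a
  ifZero-0 {x = x} x≡0 rewrite dec-true (x ≟ 0#) x≡0 = ≡.refl

  ifZero-≢0 : ∀ {x a c} → x ≢ 0# → (ifZero x then a else c) ≡ c
  ifZero-≢0 {x = x} x≢0 rewrite dec-false (x ≟ 0#) x≢0 = ≡.refl

  unit-part : Carrier → Carrier
  unit-part x = ifZero x then 1# else x

  unit-part-nonzero : ∀ x → unit-part x ≢ 0#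
  unit-part-nonzero x with x ≟ 0#
  ... | yes x≡0 = λ eq → 0≢1 (≡.trans (≡.sym eq) (ifZero-0 x≡0))
  ... | no  x≢0 = λ eq → x≢0 (≡.trans (≡.sym (ifZero-≢0 x≢0)) eq)

  unit-part-* : ∀ {a} → a ≢ 0# → ∀ x → unit-part (a * x) ≈ (ifZero x then 1# else a) * unit-part x
  unit-part-* {a} a≢0 x with x ≟ 0#
  ... | yes x≡0 = begin
    unit-part (a * x)                        ≡⟨ ifZero-0 (≈⇒≡ (trans (*-congˡ (reflexive x≡0)) (zeroʳ a))) ⟩
    1#                                       ≈⟨ *-identityˡ 1# ⟨
    1# * 1#                                  ≡⟨ ≡.cong₂ _*_ (ifZero-0 x≡0) (ifZero-0 x≡0) ⟨
    (ifZero x then 1# else a) * unit-part x  ∎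
  ... | no x≢0 = begin
    unit-part (a * x)                        ≡⟨ ifZero-≢0 (*-nonzero a≢0 x≢0) ⟩
    a * x                                    ≡⟨ ≡.cong₂ _*_ (ifZero-≢0 x≢0) (ifZero-≢0 x≢0) ⟨
    (ifZero x then 1# else a) * unit-part x  ∎

  -- Multiplying every element by a permutes the nonzero elements; compare the products of their unit parts.
  fermat : ∀ {a} → a ≢ 0# → a ^ (q ∸ 1) ≈ 1#
  fermat {a} a≢0 = sym (*-leftCancellable P≢0 (begin
    P * 1#                                            ≈⟨ *-identityʳ P ⟩
    P                                                 ≈⟨ sum-reindex enum (scaling a≢0) unit-part ⟩
    product (unit-part ∘ (a *_) ∘ to)                 ≈⟨ product-cong (unit-part-* a≢0 ∘ to) ⟩
    product (λ i → factor (to i) * unit-part (to i))  ≈⟨ ∏-distrib-* (factor ∘ to) (unit-part ∘ to) ⟩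
    product (factor ∘ to) * P                         ≈⟨ *-congʳ (sum-const-except (from 0#) (factor ∘ to) factor-0 factor-≢0) ⟩
    a ^ (q ∸ 1) * P                                   ≈⟨ *-comm _ P ⟩
    P * a ^ (q ∸ 1)                                   ∎))
    where
    open CommutativeMonoidSum *-commutativeMonoid using (sum-reindex; sum-const-except)
    open import Algebra.Properties.CommutativeMonoid.Sum *-commutativeMonoid
      using () renaming (sum to product; ∑-distrib-+ to ∏-distrib-*; sum-cong-≋ to product-cong)

    product-nonzero : ∀ {N} (f : Fin N → Carrier) → (∀ i → f i ≢ 0#) → product f ≢ 0#
    product-nonzero {zero}  f _   = 0≢1 ∘ ≡.sym
    product-nonzero {suc N} f f≢0 = *-nonzero (f≢0 zero) (product-nonzero (f ∘ suc) (f≢0 ∘ suc))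

    P = product (unit-part ∘ to)
    P≢0 = product-nonzero (unit-part ∘ to) (unit-part-nonzero ∘ to)

    factor : Carrier → Carrier
    factor x = ifZero x then 1# else a

    factor-0 : factor (to (from 0#)) ≈ 1#
    factor-0 = reflexive (ifZero-0 (strictlyInverseˡ 0#))

    factor-≢0 : ∀ i → i ≢ from 0# → factor (to i) ≈ a
    factor-≢0 i i≢z = reflexive (ifZero-≢0 λ to-i≡0 →
      i≢z (≡.trans (≡.sym (strictlyInverseʳ i)) (≡.cong from to-i≡0)))

module PaleyTheory {q : ℕ} (F : FiniteField q) (k : ℕ) where

  open FiniteField F hiding (zero)
  open FiniteFieldTheory F
  open Paley F k
  open import Algebra.Properties.AbelianGroup +-abelianGroup using (xyx⁻¹≈y)
  open import Algebra.Properties.Semiring.Mult semiring using () renaming (_×_ to _·_)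
  open import Relation.Binary.Reasoning.Setoid setoid
  open Inverse enum using (to; from; strictlyInverseˡ; strictlyInverseʳ)

  cycle-dividing-all⇒HasPeriod : ∀ {d} → Cycle d → (∀ n → Cycle n → d ∣ n) → HasPeriod d
  cycle-dividing-all⇒HasPeriod d-cycle d∣cycles = d∣cycles , λ e e∣cycles → e∣cycles _ d-cycle

  coprime-cycles⇒HasPeriod-1 : ∀ {a b} → Cycle a → Cycle b → Coprime a b → HasPeriod 1
  coprime-cycles⇒HasPeriod-1 a-cycle b-cycle a⊥b =
    (λ n _ → 1∣ n) , λ e e∣cycles → ≡.subst (e ∣_) (a⊥b (e∣cycles _ a-cycle , e∣cycles _ b-cycle)) ∣-refl

  arc-+ : ∀ {r} x → InR r → Arc x (r + x)
  arc-+ {r} x (z , z≢0 , zᵏ≡r) =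
    z , z≢0 , ≡.trans zᵏ≡r (≈⇒≡ (sym (trans (+-congʳ (+-comm r x)) (xyx⁻¹≈y x r))))

  1∈R : InR 1#
  1∈R = 1# , 0≢1 ∘ ≡.sym , ≈⇒≡ (Multiplicative.n·ε≈ε k)

  unit-cycle : Cycle char
  unit-cycle = positive , (_· 1#) , ≈⇒≡ annihilates , (λ i _ → arc-+ (i · 1#) 1∈R) ,
               λ i j i<j j<char → ·-injective (+-leftCancellable 1#) i<j j<char ∘ reflexive
    where open Additive.IsOrder char-isOrder

  module GeometricCycle {y} (y≢0 : y ≢ 0#) (yᵏ≢1 : y ^ k ≢ 1#) where

    g : Carrier
    g = y ^ k

    g≢0 : g ≢ 0#
    g≢0 = ^-nonzero k y≢0

    order : ∃ (Multiplicative.IsOrder g)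
    order = Multiplicative.order-exists _≈?_ from from-injective (*-leftCancellable g≢0)

    o : ℕ
    o = proj₁ order

    open Multiplicative.IsOrder (proj₂ order) using (positive; annihilates; ·-injective)

    series : ℕ → Carrier
    series zero    = 0#
    series (suc i) = g ^ i + series i

    series-shift : ∀ i → g * series i + 1# ≈ series (suc i)
    series-shift zero    = trans (+-congʳ (zeroʳ g)) (trans (+-identityˡ 1#) (sym (+-identityʳ 1#)))
    series-shift (suc i) = begin
      g * (g ^ i + series i) + 1#         ≈⟨ +-congʳ (distribˡ g (g ^ i) (series i)) ⟩
      g * g ^ i + g * series i + 1#       ≈⟨ +-assoc _ _ _ ⟩
      g * g ^ i + (g * series i + 1#)     ≈⟨ +-congˡ (series-shift i) ⟩
      g * g ^ i + series (suc i)          ∎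

    series-period : series o ≡ 0#
    series-period with series o ≟ 0#
    ... | yes S≡0 = S≡0
    ... | no  S≢0 = contradiction (≈⇒≡ (*-leftCancellable S≢0 (begin
      S * g       ≈⟨ *-comm S g ⟩
      g * S       ≈⟨ +-rightCancellable 1# (begin
        g * S + 1#  ≈⟨ series-shift o ⟩
        g ^ o + S   ≈⟨ +-congʳ annihilates ⟩
        1# + S      ≈⟨ +-comm 1# S ⟩
        S + 1#      ∎) ⟩
      S           ≈⟨ *-identityʳ S ⟨
      S * 1#      ∎))) yᵏ≢1
      where S = series o

    series-injective : ∀ {i j} → i < j → j < o → series i ≢ series j
    series-injective {i} {j} i<j j<o Sᵢ≡Sⱼ = ·-injective (*-leftCancellable g≢0) i<j j<o
      (+-rightCancellable (series i) (begin
        g ^ i + series i      ≈⟨ series-shift i ⟨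
        g * series i + 1#     ≡⟨ ≡.cong (λ S → g * S + 1#) Sᵢ≡Sⱼ ⟩
        g * series j + 1#     ≈⟨ series-shift j ⟩
        g ^ j + series j      ≡⟨ ≡.cong (g ^ j +_) Sᵢ≡Sⱼ ⟨
        g ^ j + series i      ∎))

    gⁱ∈R : ∀ i → InR (g ^ i)
    gⁱ∈R i = y ^ i , ^-nonzero i y≢0 , ≈⇒≡ (^-swap y i k)

    cycle : Cycle o
    cycle = positive , series , series-period , (λ i _ → arc-+ (series i) (gⁱ∈R i)) ,
            λ i j i<j j<o → series-injective i<j j<o

  -- The two cycle lengths are coprime: char ∣ q, while the order of y ^ k divides q - 1 by Fermat.
  nontrivial⇒HasPeriod-1 : ∀ {y} → y ≢ 0# → y ^ k ≢ 1# → HasPeriod 1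
  nontrivial⇒HasPeriod-1 y≢0 yᵏ≢1 = coprime-cycles⇒HasPeriod-1 unit-cycle cycle
    (divisors-of-successive-coprime (≡.subst (char ∣_) (≡.sym (m+[n∸m]≡n (>-nonZero⁻¹ q))) char∣q)
                                    (Multiplicative.IsOrder.∣-annihilating (proj₂ order) (fermat g≢0)))
    where open GeometricCycle y≢0 yᵏ≢1

  Rₖ-trivial : Set
  Rₖ-trivial = ∀ y → y ≢ 0# → y ^ k ≡ 1#

  Rₖ-trivial-or-witness : Rₖ-trivial ⊎ ∃ λ y → y ≢ 0# × y ^ k ≢ 1#
  Rₖ-trivial-or-witness with Fin.any? (λ i → ¬? (to i ≟ 0#) ×-dec ¬? ((to i ^ k) ≟ 1#))
  ... | yes (i , witness) = inj₂ (to i , witness)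
  ... | no  no-witness    = inj₁ λ y y≢0 → decidable-stable ((y ^ k) ≟ 1#) λ yᵏ≢1 →
          no-witness (from y , ≡.subst (λ x → x ≢ 0# × x ^ k ≢ 1#) (≡.sym (strictlyInverseˡ y)) (y≢0 , yᵏ≢1))

  module Trivial (trivial : Rₖ-trivial) where

    open Additive.IsOrder char-isOrder using (nonZero; ∣-annihilating; n·x≈[n%o]·x; ·-injective; minimal)

    arc⇒unit-step : ∀ {x y} → Arc x y → y ≈ 1# + x
    arc⇒unit-step {x} {y} (z , z≢0 , zᵏ≡y-x) = begin
      y          ≈⟨ x∙y⁻¹∙y≈x +-group y x ⟨
      y - x + x  ≡⟨ ≡.cong (_+ x) (≡.trans (≡.sym zᵏ≡y-x) (trivial z z≢0)) ⟩
      1# + x     ∎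

    walk-position : ∀ {n} (v : ℕ → Carrier) → (∀ i → i < n → Arc (v i) (v (suc i))) →
                    ∀ i → i ≤ n → v i ≈ i · 1# + v 0
    walk-position v arcs zero    _   = sym (+-identityˡ (v 0))
    walk-position v arcs (suc i) i<n = begin
      v (suc i)                ≈⟨ arc⇒unit-step (arcs i i<n) ⟩
      1# + v i                 ≈⟨ +-congˡ (walk-position v arcs i (<⇒≤ i<n)) ⟩
      1# + (i · 1# + v 0)      ≈⟨ +-assoc 1# (i · 1#) (v 0) ⟨
      suc i · 1# + v 0         ∎

    char∣cycle-length : ∀ n → Cycle n → char ∣ n
    char∣cycle-length n (_ , v , vₙ≡v₀ , arcs , _) = ∣-annihilating (+-rightCancellable (v 0) (begin
      n · 1# + v 0   ≈⟨ walk-position v arcs n ≤-refl ⟨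
      v n            ≡⟨ vₙ≡v₀ ⟩
      v 0            ≈⟨ +-identityˡ (v 0) ⟨
      0# + v 0       ∎))

    HasPeriod-char : HasPeriod char
    HasPeriod-char = cycle-dividing-all⇒HasPeriod unit-cycle char∣cycle-length

    strongly-connected⇒multiple-of-1 : StronglyConnected → ∀ x → ∃[ n ] x ≈ n · 1#
    strongly-connected⇒multiple-of-1 connected x with connected 0# x
    ... | n , v , v₀≡0 , vₙ≡x , arcs = n , (begin
      x              ≡⟨ vₙ≡x ⟨
      v n            ≈⟨ walk-position v arcs n ≤-refl ⟩
      n · 1# + v 0   ≡⟨ ≡.cong (n · 1# +_) v₀≡0 ⟩
      n · 1# + 0#    ≈⟨ +-identityʳ _ ⟩
      n · 1#         ∎)

    strongly-connected⇒q≤char : StronglyConnected → q ≤ char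
    strongly-connected⇒q≤char connected = Fin.injective⇒≤ {f = residue} residue-injective
      where
      multiple-of-1 = strongly-connected⇒multiple-of-1 connected

      residue : Fin q → Fin char
      residue i = fromℕ< (m%n<n (proj₁ (multiple-of-1 (to i))) char)

      residue-injective : ∀ {i j} → residue i ≡ residue j → i ≡ j
      residue-injective {i} {j} eq = ≡.trans (≡.sym (strictlyInverseʳ i))
        (≡.trans (≡.cong from (≈⇒≡ (begin
          to i                 ≈⟨ proj₂ (multiple-of-1 (to i)) ⟩
          mᵢ · 1#              ≈⟨ n·x≈[n%o]·x mᵢ ⟩
          (mᵢ % char) · 1#     ≡⟨ ≡.cong (_· 1#) residues-equal ⟩
          (mⱼ % char) · 1#     ≈⟨ n·x≈[n%o]·x mⱼ ⟨
          mⱼ · 1#              ≈⟨ proj₂ (multiple-of-1 (to j)) ⟨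
          to j                 ∎))) (strictlyInverseʳ j))
        where
        mᵢ = proj₁ (multiple-of-1 (to i))
        mⱼ = proj₁ (multiple-of-1 (to j))
        residues-equal : mᵢ % char ≡ mⱼ % char
        residues-equal = ≡.trans (≡.sym (Fin.toℕ-fromℕ< _)) (≡.trans (≡.cong toℕ eq) (Fin.toℕ-fromℕ< _))

    char∸1≤k : 0 < k → char ∸ 1 ≤ k
    char∸1≤k 0<k = ≡.subst₂ _≤_ (length-applyUpTo _ (char ∸ 1))
      (≡.trans (≡.cong suc (length-replicate (k ∸ 1))) (m+[n∸m]≡n 0<k))
      (roots≤degree 1≉0 no-zero-divisors roots (xⁿ⁺¹-1 (k ∸ 1)) distinct are-roots)
      where
      open MonicPolynomial commRing

      below-char : ∀ {i} → i < char ∸ 1 → suc i < char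
      below-char i<char∸1 = ≡.subst (_ ≤_) (m+[n∸m]≡n (Additive.IsOrder.positive char-isOrder)) (s≤s i<char∸1)

      roots : List Carrier
      roots = applyUpTo (λ i → suc i · 1#) (char ∸ 1)

      distinct : AllPairs (λ r s → ¬ r ≈ s) roots
      distinct = AllPairsₚ.applyUpTo⁺₁ _ (char ∸ 1) λ i<j j<char∸1 →
        ·-injective (+-leftCancellable 1#) (s≤s i<j) (below-char j<char∸1)

      are-roots : All (λ r → eval (xⁿ⁺¹-1 (k ∸ 1)) r ≈ 0#) roots
      are-roots = Allₚ.applyUpTo⁺₁ _ (char ∸ 1) λ {i} i<char∸1 → begin
        eval (xⁿ⁺¹-1 (k ∸ 1)) (suc i · 1#)   ≈⟨ eval-xⁿ⁺¹-1 (k ∸ 1) _ ⟩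
        - 1# + (suc i · 1#) ^ suc (k ∸ 1)   ≡⟨ ≡.cong (λ e → - 1# + (suc i · 1#) ^ e) (m+[n∸m]≡n 0<k) ⟩
        - 1# + (suc i · 1#) ^ k             ≡⟨ ≡.cong (- 1# +_) (trivial _ (minimal z<s (below-char i<char∸1) ∘ reflexive)) ⟩
        - 1# + 1#                           ≈⟨ -‿inverseˡ 1# ⟩
        0#                                  ∎

    connected⇒prime-field : StronglyConnected → k ∣ q ∸ 1 → Prime q × k ≡ q ∸ 1
    connected⇒prime-field connected k∣q∸1 =
      ≡.subst Prime (≡.sym q≡char) char-prime , ≤-antisym k≤q∸1 q∸1≤k
      where
      q≡char : q ≡ char
      q≡char = ≤-antisym (strongly-connected⇒q≤char connected) (∣⇒≤ char∣q)
      0<q∸1 : 0 < q ∸ 1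
      0<q∸1 = m<n⇒0<n∸m (≡.subst (1 <_) (≡.sym q≡char) 1<char)
      0<k : 0 < k
      0<k = ℕₚ.n≢0⇒n>0 λ k≡0 → <⇒≢ 0<q∸1 (≡.sym (0∣⇒≡0 (≡.subst (_∣ q ∸ 1) k≡0 k∣q∸1)))
      k≤q∸1 : k ≤ q ∸ 1
      k≤q∸1 = ∣⇒≤ {{>-nonZero 0<q∸1}} k∣q∸1
      q∸1≤k : q ∸ 1 ≤ k
      q∸1≤k = ≡.subst (λ n → n ∸ 1 ≤ k) (≡.sym q≡char) (char∸1≤k 0<k)

  prime-field⇒HasPeriod-q : Prime q → k ≡ q ∸ 1 → HasPeriod q
  prime-field⇒HasPeriod-q q-prime k≡q∸1 = ≡.subst HasPeriod char≡q (Trivial.HasPeriod-char trivial)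
    where
    trivial : Rₖ-trivial
    trivial y y≢0 = ≡.subst (λ e → y ^ e ≡ 1#) (≡.sym k≡q∸1) (≈⇒≡ (fermat y≢0))
    char≡q : char ≡ q
    char≡q = [ (λ char≡1 → contradiction char≡1 nonTrivial⇒≢1) , (λ char≡q → char≡q) ]′
               (prime⇒irreducible q-prime char∣q)

-- ℕ's _^_ enters scope only here, where it no longer clashes with the field's.
open import Data.Nat using (_^_)

proposition7p2 : (p m k : ℕ) → Prime p → p ≢ 2 → k ∣ (p ^ m ∸ 1) →
    (F : FiniteField (p ^ m)) →
    Paley.Directed F k → Paley.StronglyConnected F k →
    ((m ≡ 1 × k ≡ p ∸ 1) → Paley.HasPeriod F k p) ×
    (¬ (m ≡ 1 × k ≡ p ∸ 1) → Paley.HasPeriod F k 1)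
proposition7p2 p m k p-prime _ k∣q∸1 F _ connected = exceptional , generic
  where
  open PaleyTheory F k

  p¹≡p : p ^ 1 ≡ p
  p¹≡p = ℕₚ.*-identityʳ p

  exceptional : m ≡ 1 × k ≡ p ∸ 1 → Paley.HasPeriod F k p
  exceptional (≡.refl , k≡p∸1) = ≡.subst (Paley.HasPeriod F k) p¹≡p
    (prime-field⇒HasPeriod-q (≡.subst Prime (≡.sym p¹≡p) p-prime) (≡.trans k≡p∸1 (≡.cong (_∸ 1) (≡.sym p¹≡p))))

  generic : ¬ (m ≡ 1 × k ≡ p ∸ 1) → Paley.HasPeriod F k 1
  generic not-exceptional with Rₖ-trivial-or-witness
  ... | inj₂ (y , y≢0 , yᵏ≢1) = nontrivial⇒HasPeriod-1 y≢0 yᵏ≢1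
  ... | inj₁ trivial = contradiction (m≡1 , k≡p∸1) not-exceptional
    where
    prime-field = Trivial.connected⇒prime-field trivial connected k∣q∸1
    m≡1 : m ≡ 1
    m≡1 = prime-power-prime⇒exponent≡1 m p-prime (proj₁ prime-field)
    k≡p∸1 : k ≡ p ∸ 1
    k≡p∸1 = ≡.trans (proj₂ prime-field) (≡.cong (_∸ 1) (≡.trans (≡.cong (p ^_) m≡1) p¹≡p))
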